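{- Let $H=(V,E)$ be a graph on $k\ge4$ vertices with at least one edge, other than $K_k$ and $K_{1,k-1}$. Then $H$ has a spanning subgraph $H'=(V,E')$ with $E'\subseteq E$, maximum degree $\Delta(H')\le2$, and $e(H')>2e(H)/(k-1)$.
   Context: $e(\cdot)$ denotes the number of edges and $\Delta(\cdot)$ the maximum degree; $K_k$ is the complete graph and $K_{1,k-1}$ the star on $k$ vertices. -}

module Defs where

open import Data.Nat using (ℕ; zero; suc; _+_; _*_; _≤_; _<_)
open import Data.Fin using (Fin; toℕ)
open import Data.Bool using (Bool; true; false; if_then_else_)
open import Data.List using (List; map)
open import Data.Nat.ListAction using (sum)
open import Data.List using () renaming (allFin to allFinL)
open import Data.Product using (Σ; _×_; _,_; ∃)
open import Relation.Binary.PropositionalEquality using (_≡_; _≢_)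

record Graph (k : ℕ) : Set where
  field
    adj   : Fin k → Fin k → Bool
    sym   : ∀ i j → adj i j ≡ adj j i
    irref : ∀ i → adj i i ≡ false
open Graph public

b2n : Bool → ℕ
b2n true  = 1
b2n false = 0

deg : {k : ℕ} → Graph k → Fin k → ℕ
deg {k} G i = sum (map (λ j → b2n (adj G i j)) (allFinL k))


edges : {k : ℕ} → Graph k → ℕ
edges {k} G = sum (map (λ i → sum (map (λ j → if toℕ i Data.Nat.<ᵇ toℕ j then b2n (adj G i j) else 0)
                                        (allFinL k)))
                      (allFinL k))

MaxDegLe : {k : ℕ} → Graph k → ℕ → Set
MaxDegLe G d = ∀ i → deg G i ≤ d

SubgraphOf : {k : ℕ} → Graph k → Graph k → Set
SubgraphOf H' H = ∀ i j → adj H' i j ≡ true → adj H i j ≡ true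

IsComplete : {k : ℕ} → Graph k → Set
IsComplete H = ∀ i j → i ≢ j → adj H i j ≡ true

IsStar : {k : ℕ} → Graph k → Set
IsStar {k} H = Σ (Fin k) λ c →
  (∀ j → j ≢ c → adj H c j ≡ true) ×
  (∀ i j → i ≢ c → j ≢ c → adj H i j ≡ false)

HasEdge : {k : ℕ} → Graph k → Set
HasEdge {k} H = Σ (Fin k) λ i → Σ (Fin k) λ j → adj H i j ≡ true

-- A permutation σ of the vertices whose cycles all have length at least 3 (a cycle cover) picks
-- out the pairs {a, σ a}; those that are edges of H form a subgraph of maximum degree 2 with as
-- many edges as there are arcs a ↦ σ a along edges of H.  Averaged over all cycle covers of K_N
-- this number is 2e(H)/(N − 1), so it suffices to find a cover beating the average.  By induction
-- on N: delete vertex 0 and reinsert it after some vertex a into an above-average cover of H − 0;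
-- averaging over a shows that some a keeps the cover above average.  This only fails when H − 0
-- is empty, complete, a star, or a clique plus an isolated vertex, the graphs on which every cover
-- hits exactly the average.  Then a cover is chosen by hand according to the neighbourhood of 0,
-- unless H itself is of one of these four kinds.  The first three are excluded by hypothesis; for
-- K_(N−1) + K_1 a permutation fixing the isolated vertex and cycling the others has
-- N − 1 > 2e(H)/(N − 1) = N − 2 edges along H.
module Submission where

open import Data.Bool using (Bool; true; false; _∧_; _∨_; if_then_else_)
open import Data.Bool.Properties using (∨-comm; ¬-not) renaming (_≟_ to _≟ᵇ_)
open import Data.Fin using (Fin; zero; suc; toℕ; punchIn; punchOut)
open import Data.Fin.Patterns using (0F; 1F; 2F)
open import Data.Fin.Permutation
  using (Permutation′; permutation; _⟨$⟩ʳ_; _⟨$⟩ˡ_; inverseˡ; inverseʳ; lift₀; transpose; _∘ₚ_;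
         insert; insert-punchIn)
open import Data.Fin.Properties
  using (_≟_; suc-injective; toℕ-injective; punchInᵢ≢i; punchIn-injective; punchIn-punchOut;
         any?; all?; ¬∀⟶∃¬)
open import Data.List using ([]; _∷_; tabulate; allFin; map)
open import Data.List.Properties using (map-tabulate)
import Data.Nat.ListAction as List
open import Data.Nat using (ℕ; zero; suc; _+_; _*_; _≤_; _<_; _∸_; z≤n; s≤s; _<ᵇ_)
open import Data.Nat.Properties hiding (_≟_; suc-injective)
open import Algebra.Properties.Semiring.Sum +-*-semiring
  using (sum; sum-cong-≗; ∑-distrib-+; ∑-comm; sum-permute; sum-remove)
open import Data.Nat.Tactic.RingSolver using (solve-∀; solve)
open import Data.Product using (Σ; _×_; _,_; proj₁; proj₂)
open import Data.Sum using (_⊎_; inj₁; inj₂)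
open import Data.Vec.Functional using (removeAt)
open import Defs renaming (sym to adj-sym; irref to adj-irrefl)
open import Function using (_∘_; id)
open import Relation.Binary.PropositionalEquality
open import Relation.Nullary using (¬_; Dec; does; yes; no; contradiction)
open import Relation.Nullary.Decidable
  using (dec-true; dec-false; dec-yes; ¬?; _×-dec_; _→-dec_; from-yes)
open import Relation.Nullary.Reflects using (ofʸ; ofⁿ)

∑-mono-≤ : ∀ {n} {f g : Fin n → ℕ} → (∀ i → f i ≤ g i) → sum f ≤ sum g
∑-mono-≤ {zero}  f≤g = z≤n
∑-mono-≤ {suc n} f≤g = +-mono-≤ (f≤g zero) (∑-mono-≤ (f≤g ∘ suc))

∑-const : ∀ n (c : ℕ) → sum {n} (λ _ → c) ≡ n * c
∑-const zero    c = refl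
∑-const (suc n) c = cong (c +_) (∑-const n c)

∑-1 : ∀ n → sum {n} (λ _ → 1) ≡ n
∑-1 n = trans (∑-const n 1) (*-identityʳ n)

∑-*ʳ : ∀ {n} (f : Fin n → ℕ) (c : ℕ) → sum (λ i → f i * c) ≡ sum f * c
∑-*ʳ {zero}  f c = refl
∑-*ʳ {suc n} f c = trans (cong (f zero * c +_) (∑-*ʳ (f ∘ suc) c))
                         (sym (*-distribʳ-+ c (f zero) (sum (f ∘ suc))))

∑-permute : ∀ {n} (f : Fin n → ℕ) (σ : Permutation′ n) → sum (λ a → f (σ ⟨$⟩ʳ a)) ≡ sum f
∑-permute f σ = sym (sum-permute f σ)

∑-update : ∀ {n} {f g : Fin n → ℕ} i → (∀ j → j ≢ i → f j ≡ g j) → sum f + g i ≡ sum g + f i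
∑-update {suc n} {f} {g} i f≡g = begin
  sum f + g i                       ≡⟨ cong (_+ g i) (sum-remove {i = i} f) ⟩
  f i + sum (removeAt f i) + g i    ≡⟨ cong (λ r → f i + r + g i) (sum-cong-≗ (λ j → f≡g _ (punchInᵢ≢i i j))) ⟩
  f i + sum (removeAt g i) + g i    ≡⟨ +-comm (f i + sum (removeAt g i)) (g i) ⟩
  g i + (f i + sum (removeAt g i))  ≡⟨ cong (g i +_) (+-comm (f i) (sum (removeAt g i))) ⟩
  g i + (sum (removeAt g i) + f i)  ≡⟨ sym (+-assoc (g i) (sum (removeAt g i)) (f i)) ⟩
  g i + sum (removeAt g i) + f i    ≡⟨ cong (_+ f i) (sym (sum-remove {i = i} g)) ⟩
  sum g + f i                       ∎
  where open ≡-Reasoning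

∃-<-of-∑-< : ∀ {n} (f g : Fin n → ℕ) → sum f < sum g → Σ (Fin n) λ i → f i < g i
∃-<-of-∑-< {suc n} f g ∑f<∑g with f zero <? g zero
... | yes f₀<g₀ = zero , f₀<g₀
... | no  f₀≮g₀ with ∃-<-of-∑-< (f ∘ suc) (g ∘ suc)
                       (+-cancelˡ-< (g zero) _ _ (≤-<-trans (+-monoˡ-≤ _ (≮⇒≥ f₀≮g₀)) ∑f<∑g))
...   | i , fi<gi = suc i , fi<gi

sum-map-allFin : ∀ {n} (f : Fin n → ℕ) → List.sum (map f (allFin n)) ≡ sum f
sum-map-allFin f = trans (cong List.sum (map-tabulate id f)) (sum-tabulate f)
  where
  sum-tabulate : ∀ {n} (f : Fin n → ℕ) → List.sum (tabulate f) ≡ sum f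
  sum-tabulate {zero}  f = refl
  sum-tabulate {suc n} f = cong (f zero +_) (sum-tabulate (f ∘ suc))

δ : ∀ {n} → Fin n → Fin n → ℕ
δ i j = b2n (does (i ≟ j))

δ-refl : ∀ {n} (i : Fin n) → δ i i ≡ 1
δ-refl i rewrite dec-true (i ≟ i) refl = refl

∑-δ-* : ∀ {n} (i : Fin n) (f : Fin n → ℕ) → sum (λ j → δ i j * f j) ≡ f i
∑-δ-* {suc n} zero    f =
  trans (cong₂ _+_ (+-identityʳ (f zero)) (trans (∑-const n 0) (*-zeroʳ n))) (+-identityʳ (f zero))
∑-δ-* {suc n} (suc i) f = ∑-δ-* i (f ∘ suc)

∑-δ : ∀ {n} (i : Fin n) → sum (δ i) ≡ 1
∑-δ i = trans (sum-cong-≗ (λ j → sym (*-identityʳ (δ i j)))) (∑-δ-* i (λ _ → 1))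

b2n≤1 : ∀ b → b2n b ≤ 1
b2n≤1 true  = s≤s z≤n
b2n≤1 false = z≤n

module _ {n} (f : Fin n → Bool) where

  count : ℕ
  count = sum (λ j → b2n (f j))

  count≤ : count ≤ n
  count≤ = ≤-trans (∑-mono-≤ (b2n≤1 ∘ f)) (≤-reflexive (∑-1 n))

  count≡0 : (∀ j → f j ≡ false) → count ≡ 0
  count≡0 none = trans (sum-cong-≗ (λ j → cong b2n (none j))) (trans (∑-const n 0) (*-zeroʳ n))

  count≤1 : ∀ a → (∀ j → j ≢ a → f j ≡ false) → count ≤ 1
  count≤1 a only-a = ≤-trans (∑-mono-≤ pointwise) (≤-reflexive (∑-δ a))
    where
    pointwise : ∀ j → b2n (f j) ≤ δ a j
    pointwise j with a ≟ j
    ... | yes _   = b2n≤1 (f j)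
    ... | no a≢j rewrite only-a j (≢-sym a≢j) = z≤n

  count≤2 : ∀ a c → (∀ j → j ≢ a → j ≢ c → f j ≡ false) → count ≤ 2
  count≤2 a c only-a-c =
    ≤-trans (∑-mono-≤ pointwise) (≤-reflexive (trans (∑-distrib-+ (δ a) (δ c)) (cong₂ _+_ (∑-δ a) (∑-δ c))))
    where
    pointwise : ∀ j → b2n (f j) ≤ δ a j + δ c j
    pointwise j with a ≟ j | c ≟ j
    ... | yes _  | _      = ≤-trans (b2n≤1 (f j)) (m≤m+n 1 _)
    ... | no _   | yes _  = b2n≤1 (f j)
    ... | no a≢j | no c≢j rewrite only-a-c j (≢-sym a≢j) (≢-sym c≢j) = z≤n

count-missing : ∀ {n} (f : Fin (suc n) → Bool) z → f z ≡ false → count f ≤ n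
count-missing {n} f z fz≡false = +-cancelʳ-≤ 1 (count f) n (begin
  count f + 1                        ≡⟨ cong (count f +_) (sym (∑-δ z)) ⟩
  count f + sum (δ z)                ≡⟨ sym (∑-distrib-+ (λ j → b2n (f j)) (δ z)) ⟩
  sum (λ j → b2n (f j) + δ z j)      ≤⟨ ∑-mono-≤ pointwise ⟩
  sum {suc n} (λ _ → 1)              ≡⟨ trans (∑-1 (suc n)) (+-comm 1 n) ⟩
  n + 1                              ∎)
  where
  open ≤-Reasoning
  pointwise : ∀ j → b2n (f j) + δ z j ≤ 1
  pointwise j with z ≟ j
  ... | yes refl rewrite fz≡false = ≤-refl
  ... | no _     = ≤-trans (≤-reflexive (+-identityʳ _)) (b2n≤1 (f j))

count-missing₂ : ∀ {n} (f : Fin (2 + n) → Bool) z w → z ≢ w → f z ≡ false → f w ≡ false → count f ≤ n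
count-missing₂ {n} f z w z≢w fz≡false fw≡false = +-cancelʳ-≤ 2 (count f) n (begin
  count f + 2                              ≡⟨ cong (count f +_) (sym (cong₂ _+_ (∑-δ z) (∑-δ w))) ⟩
  count f + (sum (δ z) + sum (δ w))        ≡⟨ cong (count f +_) (sym (∑-distrib-+ (δ z) (δ w))) ⟩
  count f + sum (λ j → δ z j + δ w j)      ≡⟨ sym (∑-distrib-+ (λ j → b2n (f j)) (λ j → δ z j + δ w j)) ⟩
  sum (λ j → b2n (f j) + (δ z j + δ w j))  ≤⟨ ∑-mono-≤ pointwise ⟩
  sum {2 + n} (λ _ → 1)                    ≡⟨ trans (∑-1 (2 + n)) (+-comm 2 n) ⟩
  n + 2                                    ∎)
  where
  open ≤-Reasoning
  pointwise : ∀ j → b2n (f j) + (δ z j + δ w j) ≤ 1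
  pointwise j with z ≟ j | w ≟ j
  ... | yes refl | yes refl = contradiction refl z≢w
  ... | yes refl | no _     rewrite fz≡false = ≤-refl
  ... | no _     | yes refl rewrite fw≡false = ≤-refl
  ... | no _     | no _     = ≤-trans (≤-reflexive (+-identityʳ _)) (b2n≤1 (f j))

edge : ∀ {n} → Graph n → Fin n → Fin n → ℕ
edge G i j = b2n (adj G i j)

edge-sym : ∀ {n} (G : Graph n) i j → edge G i j ≡ edge G j i
edge-sym G i j = cong b2n (adj-sym G i j)

edge-irrefl : ∀ {n} (G : Graph n) i → edge G i i ≡ 0
edge-irrefl G i = cong b2n (adj-irrefl G i)

deg≡count : ∀ {n} (G : Graph n) i → deg G i ≡ count (adj G i)
deg≡count G i = sum-map-allFin (edge G i)

degreeSum : ∀ {n} → Graph n → ℕ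
degreeSum G = sum (λ i → count (adj G i))

private
  edge< : ∀ {n} → Graph n → Fin n → Fin n → ℕ
  edge< G i j = if toℕ i <ᵇ toℕ j then edge G i j else 0

  edges≡∑edge< : ∀ {n} (G : Graph n) → edges G ≡ sum (λ i → sum (edge< G i))
  edges≡∑edge< {n} G = trans (sum-map-allFin (λ i → List.sum (map (edge< G i) (allFin n))))
                             (sum-cong-≗ (λ i → sum-map-allFin (edge< G i)))

  edge<-pair : ∀ {n} (G : Graph n) i j → edge< G i j + edge< G j i ≡ edge G i j
  edge<-pair G i j with toℕ i <ᵇ toℕ j | <ᵇ-reflects-< (toℕ i) (toℕ j)
                        | toℕ j <ᵇ toℕ i | <ᵇ-reflects-< (toℕ j) (toℕ i)
  ... | true  | ofʸ i<j | true  | ofʸ j<i = contradiction i<j (<⇒≯ j<i)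
  ... | true  | _       | false | _       = +-identityʳ _
  ... | false | _       | true  | _       = edge-sym G j i
  ... | false | ofⁿ i≮j | false | ofⁿ j≮i
    rewrite toℕ-injective (≤∧≮⇒≡ (≮⇒≥ j≮i) i≮j) = sym (edge-irrefl G j)

handshake : ∀ {n} (G : Graph n) → 2 * edges G ≡ degreeSum G
handshake G = begin
  2 * edges G                                          ≡⟨ cong (edges G +_) (+-identityʳ (edges G)) ⟩
  edges G + edges G                                    ≡⟨ cong₂ _+_ (edges≡∑edge< G)
                                                                    (trans (edges≡∑edge< G) (∑-comm (edge< G))) ⟩
  sum (λ i → sum (edge< G i)) + sum (λ i → sum (λ j → edge< G j i))
                                                       ≡⟨ sym (∑-distrib-+ (λ i → sum (edge< G i)) _) ⟩
  sum (λ i → sum (edge< G i) + sum (λ j → edge< G j i))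
                                                       ≡⟨ sum-cong-≗ (λ i → sym (∑-distrib-+ (edge< G i) _)) ⟩
  sum (λ i → sum (λ j → edge< G i j + edge< G j i))    ≡⟨ sum-cong-≗ (λ i → sum-cong-≗ (edge<-pair G i)) ⟩
  degreeSum G                                          ∎
  where open ≡-Reasoning

delete₀ : ∀ {n} → Graph (suc n) → Graph n
delete₀ H = record
  { adj   = λ i j → adj H (suc i) (suc j)
  ; sym   = λ i j → adj-sym H (suc i) (suc j)
  ; irref = adj-irrefl H ∘ suc
  }

deg₀≡count : ∀ {n} (H : Graph (suc n)) → deg H zero ≡ count (λ j → adj H zero (suc j))
deg₀≡count H = trans (deg≡count H zero) (cong (_+ count (λ j → adj H zero (suc j))) (edge-irrefl H zero))

edges-delete₀ : ∀ {n} (H : Graph (suc n)) → edges H ≡ deg H zero + edges (delete₀ H)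
edges-delete₀ H =
  trans (edges≡∑edge< H) (cong₂ _+_ (sym (deg₀≡count H)) (sym (edges≡∑edge< (delete₀ H))))

IsStarAt : ∀ {n} → Graph n → Fin n → Set
IsStarAt H c = (∀ j → j ≢ c → adj H c j ≡ true) × (∀ i j → i ≢ c → j ≢ c → adj H i j ≡ false)

IsCliquePlusIsolated : ∀ {n} → Graph n → Fin n → Set
IsCliquePlusIsolated H u =
  (∀ j → adj H u j ≡ false) × (∀ i j → i ≢ u → j ≢ u → i ≢ j → adj H i j ≡ true)

degreeSum-empty : ∀ {n} (G : Graph n) → (∀ i j → adj G i j ≡ false) → degreeSum G ≡ 0
degreeSum-empty {n} G empty =
  trans (sum-cong-≗ (λ i → count≡0 (adj G i) (empty i))) (trans (∑-const n 0) (*-zeroʳ n))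

degreeSum-bound : ∀ {n} (G : Graph (suc n)) → degreeSum G ≤ suc n * n
degreeSum-bound {n} G =
  ≤-trans (∑-mono-≤ (λ i → count-missing (adj G i) i (adj-irrefl G i))) (≤-reflexive (∑-const (suc n) n))

degreeSum-star : ∀ {n} (G : Graph (suc n)) c → IsStarAt G c → degreeSum G ≤ 2 * n
degreeSum-star {n} G c (_ , leaves) = begin
  degreeSum G                                                ≡⟨ sum-remove {i = c} (λ i → count (adj G i)) ⟩
  count (adj G c) + sum (λ j → count (adj G (punchIn c j)))  ≤⟨ +-mono-≤ (count-missing (adj G c) c (adj-irrefl G c))
                                                                         (∑-mono-≤ leaf-degree≤1) ⟩
  n + sum {n} (λ _ → 1)                                      ≡⟨ cong (n +_) (trans (∑-1 n) (sym (+-identityʳ n))) ⟩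
  2 * n                                                      ∎
  where
  open ≤-Reasoning
  leaf-degree≤1 : ∀ j → count (adj G (punchIn c j)) ≤ 1
  leaf-degree≤1 j = count≤1 (adj G (punchIn c j)) c (λ k → leaves (punchIn c j) k (punchInᵢ≢i c j))

degreeSum-cliquePlusIsolated : ∀ {n} (G : Graph (2 + n)) u → IsCliquePlusIsolated G u →
  degreeSum G ≤ suc n * n
degreeSum-cliquePlusIsolated {n} G u (isolated , _) = begin
  degreeSum G                                                ≡⟨ sum-remove {i = u} (λ i → count (adj G i)) ⟩
  count (adj G u) + sum (λ j → count (adj G (punchIn u j)))  ≡⟨ cong (_+ sum (λ j → count (adj G (punchIn u j))))
                                                                     (count≡0 (adj G u) isolated) ⟩
  sum (λ j → count (adj G (punchIn u j)))                    ≤⟨ ∑-mono-≤ clique-degree ⟩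
  sum {suc n} (λ _ → n)                                      ≡⟨ ∑-const (suc n) n ⟩
  suc n * n                                                  ∎
  where
  open ≤-Reasoning
  clique-degree : ∀ j → count (adj G (punchIn u j)) ≤ n
  clique-degree j = count-missing₂ (adj G (punchIn u j)) (punchIn u j) u (punchInᵢ≢i u j)
                      (adj-irrefl G _) (trans (adj-sym G _ u) (isolated _))

-- The subgraph picked out by a permutation

NoTwoCycles : ∀ {n} → Permutation′ n → Set
NoTwoCycles σ = ∀ x → σ ⟨$⟩ʳ (σ ⟨$⟩ʳ x) ≡ x → σ ⟨$⟩ʳ x ≡ x

edgesAlong : ∀ {n} → Graph n → Permutation′ n → ℕ
edgesAlong H σ = sum (λ a → edge H a (σ ⟨$⟩ʳ a))

subgraphAlong : ∀ {n} → Graph n → Permutation′ n → Graph n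
subgraphAlong H σ = record
  { adj   = λ a b → adj H a b ∧ (does (σ ⟨$⟩ʳ a ≟ b) ∨ does (σ ⟨$⟩ʳ b ≟ a))
  ; sym   = λ a b → cong₂ _∧_ (adj-sym H a b) (∨-comm (does (σ ⟨$⟩ʳ a ≟ b)) _)
  ; irref = λ a → cong (_∧ _) (adj-irrefl H a)
  }

module _ {n} (H : Graph n) (σ : Permutation′ n) where

  private
    edge-along≤δ : ∀ a b → edge (subgraphAlong H σ) a b ≤ δ (σ ⟨$⟩ʳ a) b + δ (σ ⟨$⟩ˡ a) b
    edge-along≤δ a b with adj H a b
    ... | false = z≤n
    ... | true with σ ⟨$⟩ʳ a ≟ b | σ ⟨$⟩ʳ b ≟ a
    ...   | yes _ | _        = s≤s z≤n
    ...   | no _  | no _     = z≤n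
    ...   | no _  | yes refl rewrite inverseˡ σ {b} | δ-refl b = ≤-refl

    edge-along≥ : NoTwoCycles σ → ∀ a b →
      δ (σ ⟨$⟩ʳ a) b * edge H a b + δ (σ ⟨$⟩ˡ a) b * edge H a b ≤ edge (subgraphAlong H σ) a b
    edge-along≥ noTwo a b with adj H a b in ab
    ... | false = ≤-reflexive (cong₂ _+_ (*-zeroʳ (δ (σ ⟨$⟩ʳ a) b)) (*-zeroʳ (δ (σ ⟨$⟩ˡ a) b)))
    ... | true with σ ⟨$⟩ʳ a ≟ b | σ ⟨$⟩ˡ a ≟ b
    ...   | no _     | no _        = z≤n
    ...   | yes _    | no _        = ≤-refl
    ...   | no _     | yes refl rewrite inverseʳ σ {a} | dec-true (a ≟ a) refl = ≤-refl
    ...   | yes refl | yes σ⁻¹a≡σa =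
      contradiction (trans (sym ab) (trans (cong (adj H a) σa≡a) (adj-irrefl H a))) λ ()
      where
      σa≡a : σ ⟨$⟩ʳ a ≡ a
      σa≡a = noTwo a (trans (cong (σ ⟨$⟩ʳ_) (sym σ⁻¹a≡σa)) (inverseʳ σ))

  subgraphAlong-⊆ : SubgraphOf (subgraphAlong H σ) H
  subgraphAlong-⊆ a b with adj H a b
  ... | true  = λ _ → refl
  ... | false = λ ()

  subgraphAlong-maxDeg : MaxDegLe (subgraphAlong H σ) 2
  subgraphAlong-maxDeg a = begin
    deg (subgraphAlong H σ) a                     ≡⟨ deg≡count (subgraphAlong H σ) a ⟩
    sum (edge (subgraphAlong H σ) a)              ≤⟨ ∑-mono-≤ (edge-along≤δ a) ⟩
    sum (λ b → δ (σ ⟨$⟩ʳ a) b + δ (σ ⟨$⟩ˡ a) b)  ≡⟨ ∑-distrib-+ (δ (σ ⟨$⟩ʳ a)) (δ (σ ⟨$⟩ˡ a)) ⟩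
    sum (δ (σ ⟨$⟩ʳ a)) + sum (δ (σ ⟨$⟩ˡ a))       ≡⟨ cong₂ _+_ (∑-δ (σ ⟨$⟩ʳ a)) (∑-δ (σ ⟨$⟩ˡ a)) ⟩
    2                                             ∎
    where open ≤-Reasoning

  -- Counting every edge {a, b} once from each end: once as b = σ a and once as b = σ⁻¹ a.
  edgesAlong≤edges : NoTwoCycles σ → edgesAlong H σ ≤ edges (subgraphAlong H σ)
  edgesAlong≤edges noTwo = *-cancelˡ-≤ 2 (begin
    2 * X                                              ≡⟨ cong (X +_) (+-identityʳ X) ⟩
    X + X                                              ≡⟨ sym (cong₂ _+_ ∑succArc ∑predArc) ⟩
    sum (λ a → sum (succArc a)) + sum (λ a → sum (predArc a))
                                                       ≡⟨ sym (∑-distrib-+ (λ a → sum (succArc a)) (λ a → sum (predArc a))) ⟩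
    sum (λ a → sum (succArc a) + sum (predArc a))      ≡⟨ sum-cong-≗ (λ a → sym (∑-distrib-+ (succArc a) (predArc a))) ⟩
    sum (λ a → sum (λ b → succArc a b + predArc a b))  ≤⟨ ∑-mono-≤ (λ a → ∑-mono-≤ (edge-along≥ noTwo a)) ⟩
    degreeSum (subgraphAlong H σ)                      ≡⟨ sym (handshake (subgraphAlong H σ)) ⟩
    2 * edges (subgraphAlong H σ)                      ∎)
    where
    open ≤-Reasoning
    X : ℕ
    X = edgesAlong H σ
    succArc predArc : Fin n → Fin n → ℕ
    succArc a b = δ (σ ⟨$⟩ʳ a) b * edge H a b
    predArc a b = δ (σ ⟨$⟩ˡ a) b * edge H a b
    ∑succArc : sum (λ a → sum (succArc a)) ≡ X
    ∑succArc = sum-cong-≗ (λ a → ∑-δ-* (σ ⟨$⟩ʳ a) (edge H a))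
    ∑predArc : sum (λ a → sum (predArc a)) ≡ X
    ∑predArc = begin-equality
      sum (λ a → sum (predArc a))                        ≡⟨ sum-cong-≗ (λ a → ∑-δ-* (σ ⟨$⟩ˡ a) (edge H a)) ⟩
      sum (λ a → edge H a (σ ⟨$⟩ˡ a))                    ≡⟨ sym (∑-permute (λ a → edge H a (σ ⟨$⟩ˡ a)) σ) ⟩
      sum (λ a → edge H (σ ⟨$⟩ʳ a) (σ ⟨$⟩ˡ (σ ⟨$⟩ʳ a)))  ≡⟨ sum-cong-≗ (λ a → trans (cong (edge H (σ ⟨$⟩ʳ a)) (inverseˡ σ))
                                                                                     (edge-sym H (σ ⟨$⟩ʳ a) a)) ⟩
      X                                                  ∎

LargeSubgraphOfMaxDeg2 : ∀ {k} → Graph k → Set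
LargeSubgraphOfMaxDeg2 {k} H =
  Σ (Graph k) λ H' → SubgraphOf H' H × MaxDegLe H' 2 × (2 * edges H < edges H' * (k ∸ 1))

subgraphAlong-large : ∀ {k} (H : Graph k) (σ : Permutation′ k) → NoTwoCycles σ →
  2 * edges H < edgesAlong H σ * (k ∸ 1) → LargeSubgraphOfMaxDeg2 H
subgraphAlong-large {k} H σ noTwo 2e<X =
  subgraphAlong H σ , subgraphAlong-⊆ H σ , subgraphAlong-maxDeg H σ ,
  <-≤-trans 2e<X (*-monoˡ-≤ (k ∸ 1) (edgesAlong≤edges H σ noTwo))

-- Cycle covers

-- Permutations all of whose cycles have length at least 3, i.e. oriented 2-factors of K_n.
record CycleCover (n : ℕ) : Set where
  field
    perm         : Permutation′ n
    fixpointFree : ∀ x → perm ⟨$⟩ʳ x ≢ x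
    no2Cycle     : ∀ x → perm ⟨$⟩ʳ (perm ⟨$⟩ʳ x) ≢ x
open CycleCover public

cycleCover-noTwoCycles : ∀ {n} (σ : CycleCover n) → NoTwoCycles (perm σ)
cycleCover-noTwoCycles σ x σσx≡x = contradiction σσx≡x (no2Cycle σ x)

⟨$⟩ʳ-injective : ∀ {n} (σ : Permutation′ n) {x y} → σ ⟨$⟩ʳ x ≡ σ ⟨$⟩ʳ y → x ≡ y
⟨$⟩ʳ-injective σ eq = trans (sym (inverseˡ σ)) (trans (cong (σ ⟨$⟩ˡ_) eq) (inverseˡ σ))

-- The new vertex 0 is put between a and σ a; the old vertices are shifted by suc.
insertAfter : ∀ {n} → Permutation′ n → Fin n → Permutation′ (suc n)
insertAfter σ a = lift₀ σ ∘ₚ transpose zero (suc (σ ⟨$⟩ʳ a))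

module _ {n} (σ : Permutation′ n) (a : Fin n) where

  insertAfter-at : insertAfter σ a ⟨$⟩ʳ suc a ≡ zero
  insertAfter-at rewrite dec-true (σ ⟨$⟩ʳ a ≟ σ ⟨$⟩ʳ a) refl = refl

  insertAfter-other : ∀ {b} → b ≢ a → insertAfter σ a ⟨$⟩ʳ suc b ≡ suc (σ ⟨$⟩ʳ b)
  insertAfter-other {b} b≢a rewrite dec-false (σ ⟨$⟩ʳ b ≟ σ ⟨$⟩ʳ a) (b≢a ∘ ⟨$⟩ʳ-injective σ) = refl

insertAfterCC : ∀ {n} → CycleCover n → Fin n → CycleCover (suc n)
insertAfterCC σ a = record { perm = τ ; fixpointFree = τ-fixpointFree ; no2Cycle = τ-no2Cycle }
  where
  s : Permutation′ _
  s = perm σ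
  τ : Permutation′ _
  τ = insertAfter s a

  τ-fixpointFree : ∀ x → τ ⟨$⟩ʳ x ≢ x
  τ-fixpointFree zero ()
  τ-fixpointFree (suc b) with b ≟ a
  ... | yes refl rewrite insertAfter-at s b      = λ ()
  ... | no b≢a   rewrite insertAfter-other s a b≢a = fixpointFree σ b ∘ suc-injective

  τ-no2Cycle : ∀ x → τ ⟨$⟩ʳ (τ ⟨$⟩ʳ x) ≢ x
  τ-no2Cycle zero rewrite insertAfter-other s a (fixpointFree σ a) = λ ()
  τ-no2Cycle (suc b) with b ≟ a
  ... | yes refl rewrite insertAfter-at s b = fixpointFree σ b ∘ suc-injective
  ... | no b≢a   rewrite insertAfter-other s a b≢a with s ⟨$⟩ʳ b ≟ a
  ...   | yes sb≡a rewrite sb≡a | insertAfter-at s a = λ ()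
  ...   | no sb≢a  rewrite insertAfter-other s a sb≢a = no2Cycle σ b ∘ suc-injective

private
  next₃ prev₃ : Fin 3 → Fin 3
  next₃ 0F = 1F
  next₃ 1F = 2F
  next₃ 2F = 0F
  prev₃ 0F = 2F
  prev₃ 1F = 0F
  prev₃ 2F = 1F

rotate₃ rotate₃⁻¹ : CycleCover 3
rotate₃ = record
  { perm         = permutation next₃ prev₃ (λ { 0F → refl ; 1F → refl ; 2F → refl })
                                           (λ { 0F → refl ; 1F → refl ; 2F → refl })
  ; fixpointFree = λ { 0F () ; 1F () ; 2F () }
  ; no2Cycle     = λ { 0F () ; 1F () ; 2F () }
  }
rotate₃⁻¹ = record
  { perm         = permutation prev₃ next₃ (λ { 0F → refl ; 1F → refl ; 2F → refl })
                                           (λ { 0F → refl ; 1F → refl ; 2F → refl })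
  ; fixpointFree = λ { 0F () ; 1F () ; 2F () }
  ; no2Cycle     = λ { 0F () ; 1F () ; 2F () }
  }

third : ∀ n (x y : Fin (3 + n)) → Σ (Fin (3 + n)) λ z → z ≢ x × z ≢ y
third n (suc x)       (suc y)       = 0F , (λ ()) , (λ ())
third n 0F            0F            = 1F , (λ ()) , (λ ())
third n 0F            1F            = 2F , (λ ()) , (λ ())
third n 0F            (suc (suc y)) = 1F , (λ ()) , (λ ())
third n 1F            0F            = 2F , (λ ()) , (λ ())
third n (suc (suc x)) 0F            = 1F , (λ ()) , (λ ())

cycleCover-through : ∀ n (a b c : Fin (3 + n)) → a ≢ b → b ≢ c → a ≢ c →
  Σ (CycleCover (3 + n)) λ σ → perm σ ⟨$⟩ʳ a ≡ b × perm σ ⟨$⟩ʳ b ≡ c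
cycleCover-through zero 0F 1F 2F _   _   _   = rotate₃ , refl , refl
cycleCover-through zero 1F 2F 0F _   _   _   = rotate₃ , refl , refl
cycleCover-through zero 2F 0F 1F _   _   _   = rotate₃ , refl , refl
cycleCover-through zero 0F 2F 1F _   _   _   = rotate₃⁻¹ , refl , refl
cycleCover-through zero 2F 1F 0F _   _   _   = rotate₃⁻¹ , refl , refl
cycleCover-through zero 1F 0F 2F _   _   _   = rotate₃⁻¹ , refl , refl
cycleCover-through zero 0F 0F _  a≢b _   _   = contradiction refl a≢b
cycleCover-through zero 1F 1F _  a≢b _   _   = contradiction refl a≢b
cycleCover-through zero 2F 2F _  a≢b _   _   = contradiction refl a≢b
cycleCover-through zero _  0F 0F _   b≢c _   = contradiction refl b≢c
cycleCover-through zero _  1F 1F _   b≢c _   = contradiction refl b≢c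
cycleCover-through zero _  2F 2F _   b≢c _   = contradiction refl b≢c
cycleCover-through zero 0F _  0F _   _   a≢c = contradiction refl a≢c
cycleCover-through zero 1F _  1F _   _   a≢c = contradiction refl a≢c
cycleCover-through zero 2F _  2F _   _   a≢c = contradiction refl a≢c
cycleCover-through (suc n) (suc a) (suc b) (suc c) a≢b b≢c a≢c
  with cycleCover-through n a b c (a≢b ∘ cong suc) (b≢c ∘ cong suc) (a≢c ∘ cong suc)
... | σ , σa≡b , σb≡c = insertAfterCC σ c ,
  trans (insertAfter-other (perm σ) c (a≢c ∘ cong suc)) (cong suc σa≡b) ,
  trans (insertAfter-other (perm σ) c (b≢c ∘ cong suc)) (cong suc σb≡c)
cycleCover-through (suc n) 0F (suc b) (suc c) _ b≢c _ with third n b c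
... | x , x≢b , x≢c with cycleCover-through n x b c x≢b (b≢c ∘ cong suc) x≢c
...   | σ , σx≡b , σb≡c = insertAfterCC σ x ,
  cong suc σx≡b ,
  trans (insertAfter-other (perm σ) x (≢-sym x≢b)) (cong suc σb≡c)
cycleCover-through (suc n) (suc a) 0F (suc c) _ _ a≢c with third n a c
... | y , y≢a , y≢c with cycleCover-through n a c y (a≢c ∘ cong suc) (≢-sym y≢c) (≢-sym y≢a)
...   | σ , σa≡c , _ = insertAfterCC σ a , insertAfter-at (perm σ) a , cong suc σa≡c
cycleCover-through (suc n) (suc a) (suc b) 0F a≢b _ _ with third n a b
... | y , y≢a , y≢b with cycleCover-through n a b y (a≢b ∘ cong suc) (≢-sym y≢b) (≢-sym y≢a)
...   | σ , σa≡b , _ = insertAfterCC σ b ,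
  trans (insertAfter-other (perm σ) b (a≢b ∘ cong suc)) (cong suc σa≡b) ,
  insertAfter-at (perm σ) b
cycleCover-through (suc n) 0F 0F      _  a≢b _   _   = contradiction refl a≢b
cycleCover-through (suc n) _  0F      0F _   b≢c _   = contradiction refl b≢c
cycleCover-through (suc n) 0F (suc _) 0F _   _   a≢c = contradiction refl a≢c

someCycleCover : ∀ n → CycleCover (3 + n)
someCycleCover n = proj₁ (cycleCover-through n 0F 1F 2F (λ ()) (λ ()) (λ ()))

cycleCover-arc : ∀ n (a b : Fin (3 + n)) → a ≢ b → Σ (CycleCover (3 + n)) λ σ → perm σ ⟨$⟩ʳ a ≡ b
cycleCover-arc n a b a≢b with third n a b
... | c , c≢a , c≢b with cycleCover-through n a b c a≢b (≢-sym c≢b) (≢-sym c≢a)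
...   | σ , σa≡b , _ = σ , σa≡b

module _ {n} (u : Fin (suc n)) (σ : CycleCover n) where

  insertFixed : Permutation′ (suc n)
  insertFixed = insert u u (perm σ)

  insertFixed-u : insertFixed ⟨$⟩ʳ u ≡ u
  insertFixed-u rewrite proj₂ (dec-yes (u ≟ u) refl) = refl

  insertFixed-punchIn : ∀ k → insertFixed ⟨$⟩ʳ punchIn u k ≡ punchIn u (perm σ ⟨$⟩ʳ k)
  insertFixed-punchIn = insert-punchIn u u (perm σ)

  insertFixed-noTwoCycles : NoTwoCycles insertFixed
  insertFixed-noTwoCycles x ττx≡x = by-cases (u ≟ x)
    where
    off-u : ∀ k → insertFixed ⟨$⟩ʳ (insertFixed ⟨$⟩ʳ punchIn u k) ≢ punchIn u k
    off-u k rewrite insertFixed-punchIn k | insertFixed-punchIn (perm σ ⟨$⟩ʳ k) =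
      no2Cycle σ k ∘ punchIn-injective u _ _
    by-cases : Dec (u ≡ x) → insertFixed ⟨$⟩ʳ x ≡ x
    by-cases (yes u≡x) = subst (λ y → insertFixed ⟨$⟩ʳ y ≡ y) u≡x insertFixed-u
    by-cases (no u≢x)  = contradiction ττx≡x
      (subst (λ y → insertFixed ⟨$⟩ʳ (insertFixed ⟨$⟩ʳ y) ≢ y) (punchIn-punchOut u≢x) (off-u (punchOut u≢x)))

  edgesAlong-insertFixed : (H : Graph (suc n)) → IsCliquePlusIsolated H u → n ≤ edgesAlong H insertFixed
  edgesAlong-insertFixed H (_ , clique) = +-cancelʳ-≤ 1 n (edgesAlong H insertFixed) (begin
    n + 1                                               ≡⟨ trans (+-comm n 1) (sym (∑-1 (suc n))) ⟩
    sum {suc n} (λ _ → 1)                               ≤⟨ ∑-mono-≤ pointwise ⟩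
    sum (λ i → edge H i (insertFixed ⟨$⟩ʳ i) + δ u i)  ≡⟨ ∑-distrib-+ (λ i → edge H i (insertFixed ⟨$⟩ʳ i)) (δ u) ⟩
    edgesAlong H insertFixed + sum (δ u)                ≡⟨ cong (edgesAlong H insertFixed +_) (∑-δ u) ⟩
    edgesAlong H insertFixed + 1                        ∎)
    where
    open ≤-Reasoning
    off-u : ∀ k → 1 ≤ edge H (punchIn u k) (insertFixed ⟨$⟩ʳ punchIn u k)
    off-u k rewrite insertFixed-punchIn k
                  | clique (punchIn u k) (punchIn u (perm σ ⟨$⟩ʳ k)) (punchInᵢ≢i u k) (punchInᵢ≢i u _)
                           (fixpointFree σ k ∘ sym ∘ punchIn-injective u _ _) = ≤-refl
    pointwise : ∀ i → 1 ≤ edge H i (insertFixed ⟨$⟩ʳ i) + δ u i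
    pointwise i = by-cases (u ≟ i)
      where
      by-cases : Dec (u ≡ i) → 1 ≤ edge H i (insertFixed ⟨$⟩ʳ i) + δ u i
      by-cases (yes u≡i) = ≤-trans (≤-reflexive (sym (cong b2n (dec-true (u ≟ i) u≡i)))) (m≤n+m (δ u i) _)
      by-cases (no u≢i)  =
        ≤-trans (subst (λ x → 1 ≤ edge H x (insertFixed ⟨$⟩ʳ x)) (punchIn-punchOut u≢i) (off-u (punchOut u≢i)))
                (m≤m+n _ (δ u i))

module _ {n} (G : Graph n) where

  edgesAlong-complete : IsComplete G → (σ : CycleCover n) → n ≤ edgesAlong G (perm σ)
  edgesAlong-complete complete σ = begin
    n                      ≡⟨ sym (∑-1 n) ⟩
    sum {n} (λ _ → 1)      ≤⟨ ∑-mono-≤ (λ i → ≤-reflexive (sym (cong b2n (complete i _ (≢-sym (fixpointFree σ i)))))) ⟩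
    edgesAlong G (perm σ)  ∎
    where open ≤-Reasoning

  edgesAlong-star : ∀ {c} → IsStarAt G c → (σ : CycleCover n) →
    ∀ {b} → b ≢ c → perm σ ⟨$⟩ʳ b ≡ c → 2 ≤ edgesAlong G (perm σ)
  edgesAlong-star {c} (centre , _) σ {b} b≢c σb≡c = begin
    2                          ≡⟨ sym (cong₂ _+_ (∑-δ b) (∑-δ c)) ⟩
    sum (δ b) + sum (δ c)      ≡⟨ sym (∑-distrib-+ (δ b) (δ c)) ⟩
    sum (λ i → δ b i + δ c i)  ≤⟨ ∑-mono-≤ pointwise ⟩
    edgesAlong G (perm σ)      ∎
    where
    open ≤-Reasoning
    pointwise : ∀ i → δ b i + δ c i ≤ edge G i (perm σ ⟨$⟩ʳ i)
    pointwise i with b ≟ i | c ≟ i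
    ... | yes refl | yes refl = contradiction refl b≢c
    ... | yes refl | no _     rewrite σb≡c | edge-sym G b c | centre b b≢c = ≤-refl
    ... | no _     | yes refl rewrite centre (perm σ ⟨$⟩ʳ c) (fixpointFree σ c) = ≤-refl
    ... | no _     | no _     = z≤n

edgesAlong-cliquePlusIsolated : ∀ {n} (G : Graph (2 + n)) {u} → IsCliquePlusIsolated G u →
  (σ : CycleCover (2 + n)) → n ≤ edgesAlong G (perm σ)
edgesAlong-cliquePlusIsolated {n} G {u} (_ , clique) σ = +-cancelʳ-≤ 2 n (edgesAlong G s) (begin
  n + 2                                                      ≡⟨ trans (+-comm n 2) (sym (∑-1 (2 + n))) ⟩
  sum {2 + n} (λ _ → 1)                                      ≤⟨ ∑-mono-≤ pointwise ⟩
  sum (λ i → edge G i (s ⟨$⟩ʳ i) + (δ u i + δ u (s ⟨$⟩ʳ i)))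
                                                             ≡⟨ ∑-distrib-+ (λ i → edge G i (s ⟨$⟩ʳ i))
                                                                            (λ i → δ u i + δ u (s ⟨$⟩ʳ i)) ⟩
  edgesAlong G s + sum (λ i → δ u i + δ u (s ⟨$⟩ʳ i))      ≡⟨ cong (edgesAlong G s +_)
                                                                  (trans (∑-distrib-+ (δ u) (λ i → δ u (s ⟨$⟩ʳ i)))
                                                                         (cong₂ _+_ (∑-δ u) (trans (∑-permute (δ u) s) (∑-δ u)))) ⟩
  edgesAlong G s + 2                                         ∎)
  where
  open ≤-Reasoning
  s : Permutation′ (2 + n)
  s = perm σ
  pointwise : ∀ i → 1 ≤ edge G i (s ⟨$⟩ʳ i) + (δ u i + δ u (s ⟨$⟩ʳ i))
  pointwise i with u ≟ i | u ≟ s ⟨$⟩ʳ i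
  ... | yes _  | _       = ≤-trans (s≤s z≤n) (m≤n+m _ (edge G i (s ⟨$⟩ʳ i)))
  ... | no _   | yes _   = m≤n+m 1 _
  ... | no u≢i | no u≢si
    rewrite clique i (s ⟨$⟩ʳ i) (≢-sym u≢i) (≢-sym u≢si) (≢-sym (fixpointFree σ i)) = s≤s z≤n

module _ {n} (H : Graph (suc n)) (σ : Permutation′ n) where

  edgesAlong-insertAfter : ∀ a →
    edgesAlong H (insertAfter σ a) + edge H (suc a) (suc (σ ⟨$⟩ʳ a))
      ≡ edgesAlong (delete₀ H) σ + (edge H zero (suc a) + edge H zero (suc (σ ⟨$⟩ʳ a)))
  edgesAlong-insertAfter a = begin
    e₀ + sum F + along a    ≡⟨ +-assoc e₀ (sum F) (along a) ⟩
    e₀ + (sum F + along a)  ≡⟨ cong (e₀ +_) (∑-update a F≡along) ⟩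
    e₀ + (sum along + F a)  ≡⟨ cong (λ x → e₀ + (sum along + x)) Fa≡e₁ ⟩
    e₀ + (sum along + e₁)   ≡⟨ +-comm e₀ (sum along + e₁) ⟩
    sum along + e₁ + e₀     ≡⟨ +-assoc (sum along) e₁ e₀ ⟩
    sum along + (e₁ + e₀)   ∎
    where
    open ≡-Reasoning
    e₀ e₁ : ℕ
    e₀ = edge H zero (suc (σ ⟨$⟩ʳ a))
    e₁ = edge H zero (suc a)
    along F : Fin n → ℕ
    along b = edge H (suc b) (suc (σ ⟨$⟩ʳ b))
    F b = edge H (suc b) (insertAfter σ a ⟨$⟩ʳ suc b)
    F≡along : ∀ b → b ≢ a → F b ≡ along b
    F≡along b b≢a = cong (edge H (suc b)) (insertAfter-other σ a b≢a)
    Fa≡e₁ : F a ≡ e₁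
    Fa≡e₁ = trans (cong (edge H (suc a)) (insertAfter-at σ a)) (edge-sym H (suc a) zero)

  ∑-edges-at-zero : sum (λ a → edge H zero (suc a) + edge H zero (suc (σ ⟨$⟩ʳ a))) ≡ 2 * deg H zero
  ∑-edges-at-zero = begin
    sum (λ a → e a + edge H zero (suc (σ ⟨$⟩ʳ a)))  ≡⟨ ∑-distrib-+ e (λ a → edge H zero (suc (σ ⟨$⟩ʳ a))) ⟩
    sum e + sum (λ a → e (σ ⟨$⟩ʳ a))               ≡⟨ cong (sum e +_) (∑-permute e σ) ⟩
    sum e + sum e                                  ≡⟨ cong (λ d → d + d) (sym (deg₀≡count H)) ⟩
    deg H zero + deg H zero                        ≡⟨ cong (deg H zero +_) (sym (+-identityʳ (deg H zero))) ⟩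
    2 * deg H zero                                 ∎
    where
    open ≡-Reasoning
    e : Fin n → ℕ
    e a = edge H zero (suc a)

-- The mean of edgesAlong H over all cycle covers of the complete graph on suc n vertices is
-- 2 e(H) / n.
AboveAverageCover : ∀ {n} → Graph (suc n) → Set
AboveAverageCover {n} H = Σ (CycleCover (suc n)) λ σ → 2 * edges H < edgesAlong H (perm σ) * n

private
  averaging-arith : ∀ n d m X → 2 * m < X * n →
    suc n * (2 * (d + m)) + X * suc n < (suc n * X + 2 * d) * suc n
  averaging-arith n d m X 2m<Xn = begin-strict
    suc n * (2 * (d + m)) + X * suc n  ≡⟨ e₁ n d m X ⟩
    (2 * m + (X + 2 * d)) * suc n      <⟨ *-monoˡ-< (suc n) (+-monoˡ-< (X + 2 * d) 2m<Xn) ⟩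
    (X * n + (X + 2 * d)) * suc n      ≡⟨ e₂ n d X ⟩
    (suc n * X + 2 * d) * suc n        ∎
    where
    open ≤-Reasoning
    e₁ : ∀ n d m X → suc n * (2 * (d + m)) + X * suc n ≡ (2 * m + (X + 2 * d)) * suc n
    e₁ = solve-∀
    e₂ : ∀ n d X → (X * n + (X + 2 * d)) * suc n ≡ (suc n * X + 2 * d) * suc n
    e₂ = solve-∀

-- Summed over the N insertion points a, edgesAlong H (insertAfter σ a) totals n X₀ + 2 deg H 0.
-- Since σ is above average for H − 0 this exceeds 2 deg H 0 + 2e(H − 0) = N · 2e(H)/N, so some a
-- beats the target 2e(H)/N.
insertion-average : ∀ {n} (H : Graph (2 + n)) (σ : CycleCover (suc n)) →
  2 * edges (delete₀ H) < edgesAlong (delete₀ H) (perm σ) * n →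
  Σ (CycleCover (2 + n)) λ τ → 2 * edges H < edgesAlong H (perm τ) * suc n
insertion-average {n} H σ 2m<Xn with ∃-<-of-∑-< lower upper ∑lower<∑upper
  where
  N : ℕ
  N = suc n
  s : Permutation′ N
  s = perm σ
  X₀ d m : ℕ
  X₀ = edgesAlong (delete₀ H) s
  d = deg H zero
  m = edges (delete₀ H)
  along lower upper toZero : Fin N → ℕ
  along a = edge H (suc a) (suc (s ⟨$⟩ʳ a))
  lower a = 2 * edges H + along a * N
  upper a = (edgesAlong H (insertAfter s a) + along a) * N
  toZero a = edge H zero (suc a) + edge H zero (suc (s ⟨$⟩ʳ a))
  ∑lower<∑upper : sum lower < sum upper
  ∑lower<∑upper = begin-strict
    sum lower                                    ≡⟨ ∑-distrib-+ (λ _ → 2 * edges H) (λ a → along a * N) ⟩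
    sum {N} (λ _ → 2 * edges H) + sum (λ a → along a * N)
                                                 ≡⟨ cong₂ _+_ (trans (∑-const N (2 * edges H))
                                                                     (cong (λ e → N * (2 * e)) (edges-delete₀ H)))
                                                              (∑-*ʳ along N) ⟩
    N * (2 * (d + m)) + X₀ * N                   <⟨ averaging-arith n d m X₀ 2m<Xn ⟩
    (N * X₀ + 2 * d) * N                         ≡⟨ cong₂ (λ x y → (x + y) * N) (sym (∑-const N X₀)) (sym (∑-edges-at-zero H s)) ⟩
    (sum {N} (λ _ → X₀) + sum toZero) * N        ≡⟨ cong (_* N) (sym (∑-distrib-+ {N} (λ _ → X₀) toZero)) ⟩
    sum (λ a → X₀ + toZero a) * N                ≡⟨ cong (_* N) (sum-cong-≗ (λ a → sym (edgesAlong-insertAfter H s a))) ⟩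
    sum (λ a → edgesAlong H (insertAfter s a) + along a) * N
                                                 ≡⟨ sym (∑-*ʳ (λ a → edgesAlong H (insertAfter s a) + along a) N) ⟩
    sum upper                                    ∎
    where open ≤-Reasoning
... | a , lower<upper = insertAfterCC σ a , +-cancelʳ-< _ _ _ (<-≤-trans lower<upper (≤-reflexive
                          (*-distribʳ-+ (suc n) (edgesAlong H (insertAfter (perm σ) a)) _)))

-- Exceptional graphs

data Exceptional {n} (H : Graph n) : Set where
  empty              : (∀ i j → adj H i j ≡ false) → Exceptional H
  complete           : IsComplete H → Exceptional H
  star               : ∀ c → IsStarAt H c → Exceptional H
  cliquePlusIsolated : ∀ u → IsCliquePlusIsolated H u → Exceptional H

-- Only run on the eight graphs with three vertices, which it classifies by evaluation.
exceptional? : ∀ {n} (H : Graph n) → Dec (Exceptional H)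
exceptional? H
  with all? (λ i → all? λ j → adj H i j ≟ᵇ false)
     | all? (λ i → all? λ j → ¬? (i ≟ j) →-dec adj H i j ≟ᵇ true)
     | any? (λ c → all? (λ j → ¬? (j ≟ c) →-dec adj H c j ≟ᵇ true)
               ×-dec all? (λ i → all? λ j → ¬? (i ≟ c) →-dec ¬? (j ≟ c) →-dec adj H i j ≟ᵇ false))
     | any? (λ u → all? (λ j → adj H u j ≟ᵇ false)
               ×-dec all? (λ i → all? λ j → ¬? (i ≟ u) →-dec ¬? (j ≟ u) →-dec ¬? (i ≟ j) →-dec adj H i j ≟ᵇ true))
... | yes e | _     | _           | _           = yes (empty e)
... | _     | yes k | _           | _           = yes (complete k)
... | _     | _     | yes (c , s) | _           = yes (star c s)
... | _     | _     | _           | yes (u , i) = yes (cliquePlusIsolated u i)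
... | no ¬e | no ¬k | no ¬s       | no ¬i       = no λ
  { (empty e)                → ¬e e
  ; (complete k)             → ¬k k
  ; (star c s)               → ¬s (c , s)
  ; (cliquePlusIsolated u i) → ¬i (u , i)
  }

Exceptional-cong : ∀ {n} {G H : Graph n} → (∀ i j → adj G i j ≡ adj H i j) → Exceptional G → Exceptional H
Exceptional-cong G≡H (empty e)    = empty λ i j → trans (sym (G≡H i j)) (e i j)
Exceptional-cong G≡H (complete k) = complete λ i j i≢j → trans (sym (G≡H i j)) (k i j i≢j)
Exceptional-cong G≡H (star c (centre , leaves)) =
  star c ((λ j j≢c → trans (sym (G≡H c j)) (centre j j≢c)) ,
          (λ i j i≢c j≢c → trans (sym (G≡H i j)) (leaves i j i≢c j≢c)))
Exceptional-cong G≡H (cliquePlusIsolated u (isolated , clique)) =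
  cliquePlusIsolated u ((λ j → trans (sym (G≡H u j)) (isolated j)) ,
                        (λ i j i≢u j≢u i≢j → trans (sym (G≡H i j)) (clique i j i≢u j≢u i≢j)))

private
  graph₃ : Bool → Bool → Bool → Graph 3
  graph₃ p q r = record { adj = table ; sym = table-sym ; irref = λ { 0F → refl ; 1F → refl ; 2F → refl } }
    where
    table : Fin 3 → Fin 3 → Bool
    table 0F 1F = p
    table 1F 0F = p
    table 0F 2F = q
    table 2F 0F = q
    table 1F 2F = r
    table 2F 1F = r
    table _  _  = false
    table-sym : ∀ i j → table i j ≡ table j i
    table-sym 0F 0F = refl
    table-sym 0F 1F = refl
    table-sym 0F 2F = refl
    table-sym 1F 0F = refl
    table-sym 1F 1F = refl
    table-sym 1F 2F = refl
    table-sym 2F 0F = refl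
    table-sym 2F 1F = refl
    table-sym 2F 2F = refl

  graph₃-exceptional : ∀ p q r → Exceptional (graph₃ p q r)
  graph₃-exceptional false false false = from-yes (exceptional? (graph₃ false false false))
  graph₃-exceptional false false true  = from-yes (exceptional? (graph₃ false false true))
  graph₃-exceptional false true  false = from-yes (exceptional? (graph₃ false true  false))
  graph₃-exceptional false true  true  = from-yes (exceptional? (graph₃ false true  true))
  graph₃-exceptional true  false false = from-yes (exceptional? (graph₃ true  false false))
  graph₃-exceptional true  false true  = from-yes (exceptional? (graph₃ true  false true))
  graph₃-exceptional true  true  false = from-yes (exceptional? (graph₃ true  true  false))
  graph₃-exceptional true  true  true  = from-yes (exceptional? (graph₃ true  true  true))

exceptional₃ : (H : Graph 3) → Exceptional H
exceptional₃ H = Exceptional-cong same (graph₃-exceptional (adj H 0F 1F) (adj H 0F 2F) (adj H 1F 2F))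
  where
  same : ∀ i j → adj (graph₃ (adj H 0F 1F) (adj H 0F 2F) (adj H 1F 2F)) i j ≡ adj H i j
  same 0F 0F = sym (adj-irrefl H 0F)
  same 0F 1F = refl
  same 0F 2F = refl
  same 1F 0F = adj-sym H 0F 1F
  same 1F 1F = sym (adj-irrefl H 1F)
  same 1F 2F = refl
  same 2F 0F = adj-sym H 0F 2F
  same 2F 1F = adj-sym H 1F 2F
  same 2F 2F = sym (adj-irrefl H 2F)

private
  2[d+m]< : ∀ {d m} D M T k → d ≤ D → 2 * m ≤ M → suc (2 * D + M) + k ≡ T → 2 * (d + m) < T
  2[d+m]< {d} {m} D M T k d≤D 2m≤M eq = begin-strict
    2 * (d + m)        ≡⟨ *-distribˡ-+ 2 d m ⟩
    2 * d + 2 * m      ≤⟨ +-mono-≤ (*-monoʳ-≤ 2 d≤D) 2m≤M ⟩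
    2 * D + M          <⟨ m<m+n (2 * D + M) {suc k} (s≤s z≤n) ⟩
    2 * D + M + suc k  ≡⟨ trans (+-suc (2 * D + M) k) eq ⟩
    T                  ∎
    where open ≤-Reasoning

-- H − 0 is exceptional.  Unless H is exceptional as well, vertex 0 is inserted after a into a
-- cycle cover σ of H − 0 chosen according to the neighbourhood of 0.
module Extension {n} (H : Graph (4 + n)) where

  private
    N : ℕ
    N = 3 + n
    H₀ : Graph N
    H₀ = delete₀ H
    nb : Fin N → Bool
    nb j = adj H zero (suc j)
    d m : ℕ
    d = count nb
    m = edges H₀
    X₀ : CycleCover N → ℕ
    X₀ σ = edgesAlong H₀ (perm σ)

    non-neighbours : ∀ {P : Fin N → Set} → ¬ (Σ (Fin N) λ j → P j × nb j ≡ true) → ∀ j → P j → nb j ≡ false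
    non-neighbours ¬∃ j Pj = ¬-not λ nbj → ¬∃ (j , Pj , nbj)

    2m≤ : ∀ {M} → degreeSum H₀ ≤ M → 2 * m ≤ M
    2m≤ = ≤-trans (≤-reflexive (handshake H₀))

  -- By edgesAlong-insertAfter, this says that edgesAlong H (insertAfter (perm σ) a) ≥ L.
  InsertionBound : CycleCover N → Fin N → ℕ → Set
  InsertionBound σ a L = L + edge H₀ a (perm σ ⟨$⟩ʳ a) ≤ X₀ σ + (b2n (nb a) + b2n (nb (perm σ ⟨$⟩ʳ a)))

  Outcome : Set
  Outcome = AboveAverageCover H ⊎ Exceptional H

  extend : (σ : CycleCover N) (a : Fin N) (L : ℕ) → InsertionBound σ a L → 2 * (d + m) < L * N → Outcome
  extend σ a L L-bound 2e<LN = inj₁ (insertAfterCC σ a , (begin-strict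
    2 * edges H                                ≡⟨ cong (2 *_) (trans (edges-delete₀ H) (cong (_+ m) (deg₀≡count H))) ⟩
    2 * (d + m)                                <⟨ 2e<LN ⟩
    L * N                                      ≤⟨ *-monoˡ-≤ N L≤X ⟩
    edgesAlong H (insertAfter (perm σ) a) * N  ∎))
    where
    open ≤-Reasoning
    L≤X : L ≤ edgesAlong H (insertAfter (perm σ) a)
    L≤X = +-cancelʳ-≤ _ L _ (≤-trans L-bound (≤-reflexive (sym (edgesAlong-insertAfter H (perm σ) a))))

  fromEmpty : (∀ i j → adj H₀ i j ≡ false) → Outcome
  fromEmpty empty₀ with all? (λ j → nb j ≟ᵇ true)
  ... | yes all-nb = inj₂ (star 0F (centre , leaves))
    where
    centre : ∀ j → j ≢ 0F → adj H 0F j ≡ true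
    centre 0F      0≢0 = contradiction refl 0≢0
    centre (suc j) _   = all-nb j
    leaves : ∀ i j → i ≢ 0F → j ≢ 0F → adj H i j ≡ false
    leaves 0F      _       0≢0 _   = contradiction refl 0≢0
    leaves (suc i) 0F      _   0≢0 = contradiction refl 0≢0
    leaves (suc i) (suc j) _   _   = empty₀ i j
  ... | no ¬all with ¬∀⟶∃¬ N _ (λ j → nb j ≟ᵇ true) ¬all
  ...   | z , z∉ with any? (λ j → nb j ≟ᵇ true)
  ...     | no none = inj₂ (empty empty-H)
    where
    empty-H : ∀ i j → adj H i j ≡ false
    empty-H 0F      0F      = adj-irrefl H 0F
    empty-H 0F      (suc j) = ¬-not λ nbj → none (j , nbj)
    empty-H (suc i) 0F      = trans (adj-sym H (suc i) 0F) (¬-not λ nbi → none (i , nbi))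
    empty-H (suc i) (suc j) = empty₀ i j
  ...     | yes (a , nba) with any? (λ j → ¬? (j ≟ a) ×-dec nb j ≟ᵇ true)
  ...       | no ¬other = extend σ a 1 L-bound
                (2[d+m]< 1 0 (1 * (3 + n)) n (count≤1 nb a (non-neighbours ¬other)) 2m≤0 (solve (n ∷ [])))
    where
    σ : CycleCover N
    σ = someCycleCover n
    L-bound : InsertionBound σ a 1
    L-bound rewrite empty₀ a (perm σ ⟨$⟩ʳ a) | nba = ≤-trans (s≤s z≤n) (m≤n+m _ (X₀ σ))
    2m≤0 : 2 * m ≤ 0
    2m≤0 = 2m≤ (≤-reflexive (degreeSum-empty H₀ empty₀))
  ...       | yes (b , b≢a , nbb) with cycleCover-arc n b a b≢a
  ...         | σ , σb≡a = extend σ b 2 L-bound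
                  (2[d+m]< (2 + n) 0 (2 * (3 + n)) 1 (count-missing nb z (¬-not z∉)) 2m≤0 (solve (n ∷ [])))
    where
    L-bound : InsertionBound σ b 2
    L-bound rewrite σb≡a | empty₀ b a | nba | nbb = m≤n+m 2 (X₀ σ)
    2m≤0 : 2 * m ≤ 0
    2m≤0 = 2m≤ (≤-reflexive (degreeSum-empty H₀ empty₀))

  fromComplete : IsComplete H₀ → Outcome
  fromComplete complete₀ with all? (λ j → nb j ≟ᵇ true)
  ... | yes all-nb = inj₂ (complete complete-H)
    where
    complete-H : IsComplete H
    complete-H 0F      0F      0≢0 = contradiction refl 0≢0
    complete-H 0F      (suc j) _   = all-nb j
    complete-H (suc i) 0F      _   = trans (adj-sym H (suc i) 0F) (all-nb i)
    complete-H (suc i) (suc j) i≢j = complete₀ i j (i≢j ∘ cong suc)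
  ... | no ¬all with ¬∀⟶∃¬ N _ (λ j → nb j ≟ᵇ true) ¬all
  ...   | z , z∉ with any? (λ j → nb j ≟ᵇ true)
  ...     | no none = inj₂ (cliquePlusIsolated 0F (isolated , clique))
    where
    isolated : ∀ j → adj H 0F j ≡ false
    isolated 0F      = adj-irrefl H 0F
    isolated (suc j) = ¬-not λ nbj → none (j , nbj)
    clique : ∀ i j → i ≢ 0F → j ≢ 0F → i ≢ j → adj H i j ≡ true
    clique 0F      _       0≢0 _   _   = contradiction refl 0≢0
    clique (suc i) 0F      _   0≢0 _   = contradiction refl 0≢0
    clique (suc i) (suc j) _   _   i≢j = complete₀ i j (i≢j ∘ cong suc)
  ...     | yes (a , nba) with any? (λ j → ¬? (j ≟ a) ×-dec nb j ≟ᵇ true)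
  ...       | no ¬other = extend σ a N L-bound
                (2[d+m]< 1 ((3 + n) * (2 + n)) ((3 + n) * (3 + n)) n
                         (count≤1 nb a (non-neighbours ¬other)) (2m≤ (degreeSum-bound H₀)) (solve (n ∷ [])))
    where
    σ : CycleCover N
    σ = someCycleCover n
    L-bound : InsertionBound σ a N
    L-bound rewrite nba = +-mono-≤ (edgesAlong-complete H₀ complete₀ σ) (≤-trans (b2n≤1 _) (m≤m+n 1 _))
  ...       | yes (b , b≢a , nbb) with cycleCover-arc n b a b≢a
  ...         | σ , σb≡a = extend σ b (suc N) L-bound
                  (2[d+m]< (2 + n) ((3 + n) * (2 + n)) ((4 + n) * (3 + n)) 1
                           (count-missing nb z (¬-not z∉)) (2m≤ (degreeSum-bound H₀)) (solve (n ∷ [])))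
    where
    L-bound : InsertionBound σ b (suc N)
    L-bound rewrite σb≡a | nba | nbb =
      ≤-trans (≤-reflexive (sym (+-suc N _))) (+-mono-≤ (edgesAlong-complete H₀ complete₀ σ) (s≤s (b2n≤1 _)))

  fromStar : ∀ c → IsStarAt H₀ c → Outcome
  fromStar c star₀@(centre₀ , leaves₀) with any? (λ j → ¬? (j ≟ c) ×-dec nb j ≟ᵇ true)
  ... | yes (a , a≢c , nba) with any? (λ j → (¬? (j ≟ c) ×-dec ¬? (j ≟ a)) ×-dec nb j ≟ᵇ true)
  ...   | yes (b , (b≢c , b≢a) , nbb) with cycleCover-through n a b c (≢-sym b≢a) b≢c a≢c
  ...     | σ , σa≡b , σb≡c = extend σ a 4 L-bound
              (2[d+m]< (3 + n) (2 * (2 + n)) (4 * (3 + n)) 1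
                       (count≤ nb) (2m≤ (degreeSum-star H₀ c star₀)) (solve (n ∷ [])))
    where
    L-bound : InsertionBound σ a 4
    L-bound rewrite σa≡b | leaves₀ a b a≢c b≢c | nba | nbb =
      +-monoˡ-≤ 2 (edgesAlong-star H₀ star₀ σ b≢c σb≡c)
  fromStar c star₀@(centre₀ , leaves₀) | yes (a , a≢c , nba) | no ¬other with third n a c
  ...   | b , b≢a , b≢c with cycleCover-through n a b c (≢-sym b≢a) b≢c a≢c
  ...     | σ , σa≡b , σb≡c = extend σ a 3 L-bound
              (2[d+m]< 2 (2 * (2 + n)) (3 * (3 + n)) n
                       (count≤2 nb a c λ j j≢a j≢c → non-neighbours ¬other j (j≢c , j≢a))
                       (2m≤ (degreeSum-star H₀ c star₀)) (solve (n ∷ [])))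
    where
    L-bound : InsertionBound σ a 3
    L-bound rewrite σa≡b | leaves₀ a b a≢c b≢c | nba =
      +-mono-≤ (edgesAlong-star H₀ star₀ σ b≢c σb≡c) (m≤m+n 1 _)
  fromStar c star₀@(centre₀ , leaves₀) | no ¬noncentral with nb c ≟ᵇ true
  ... | yes nbc = inj₂ (star (suc c) (centre , leaves))
    where
    centre : ∀ j → j ≢ suc c → adj H (suc c) j ≡ true
    centre 0F      _   = trans (adj-sym H (suc c) 0F) nbc
    centre (suc j) j≢c = centre₀ j (j≢c ∘ cong suc)
    leaves : ∀ i j → i ≢ suc c → j ≢ suc c → adj H i j ≡ false
    leaves 0F      0F      _   _   = adj-irrefl H 0F
    leaves 0F      (suc j) _   j≢c = non-neighbours ¬noncentral j (j≢c ∘ cong suc)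
    leaves (suc i) 0F      i≢c _   = trans (adj-sym H (suc i) 0F) (non-neighbours ¬noncentral i (i≢c ∘ cong suc))
    leaves (suc i) (suc j) i≢c j≢c = leaves₀ i j (i≢c ∘ cong suc) (j≢c ∘ cong suc)
  ... | no ¬nbc with third n c c
  ...   | b , b≢c , _ with third n b c
  ...     | a , a≢b , a≢c with cycleCover-through n a b c a≢b b≢c a≢c
  ...       | σ , σa≡b , σb≡c = extend σ a 2 L-bound
                (2[d+m]< 0 (2 * (2 + n)) (2 * (3 + n)) 1
                         (≤-reflexive (count≡0 nb no-neighbours)) (2m≤ (degreeSum-star H₀ c star₀)) (solve (n ∷ [])))
    where
    no-neighbours : ∀ j → nb j ≡ false
    no-neighbours j with j ≟ c
    ... | yes refl = ¬-not ¬nbc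
    ... | no j≢c   = non-neighbours ¬noncentral j j≢c
    L-bound : InsertionBound σ a 2
    L-bound rewrite σa≡b | leaves₀ a b a≢c b≢c =
      ≤-trans (edgesAlong-star H₀ star₀ σ b≢c σb≡c) (m≤m+n _ _)

  fromCliquePlusIsolated : ∀ u → IsCliquePlusIsolated H₀ u → Outcome
  fromCliquePlusIsolated u cpi₀@(isolated₀ , clique₀) with any? (λ j → ¬? (j ≟ u) ×-dec nb j ≟ᵇ true)
  ... | yes (a , a≢u , nba) with cycleCover-arc n a u a≢u
  ...   | σ , σa≡u with nb u ≟ᵇ true
  ...     | yes nbu = extend σ a N L-bound
              (2[d+m]< (3 + n) ((2 + n) * (1 + n)) ((3 + n) * (3 + n)) n
                       (count≤ nb) (2m≤ (degreeSum-cliquePlusIsolated H₀ u cpi₀)) (solve (n ∷ [])))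
    where
    L-bound : InsertionBound σ a N
    L-bound rewrite σa≡u | trans (adj-sym H₀ a u) (isolated₀ a) | nba | nbu =
      ≤-trans (≤-reflexive (trans (+-identityʳ N) (+-comm 2 (1 + n))))
              (+-monoˡ-≤ 2 (edgesAlong-cliquePlusIsolated H₀ cpi₀ σ))
  ...     | no ¬nbu with any? (λ j → ¬? (j ≟ u) ×-dec nb j ≟ᵇ false)
  ...       | no ¬missing = inj₂ (cliquePlusIsolated (suc u) (isolated , clique))
    where
    neighbour : ∀ j → j ≢ u → nb j ≡ true
    neighbour j j≢u = ¬-not λ nbj → ¬missing (j , j≢u , nbj)
    isolated : ∀ j → adj H (suc u) j ≡ false
    isolated 0F      = trans (adj-sym H (suc u) 0F) (¬-not ¬nbu)
    isolated (suc j) = isolated₀ j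
    clique : ∀ i j → i ≢ suc u → j ≢ suc u → i ≢ j → adj H i j ≡ true
    clique 0F      0F      _   _   0≢0 = contradiction refl 0≢0
    clique 0F      (suc j) _   j≢u _   = neighbour j (j≢u ∘ cong suc)
    clique (suc i) 0F      i≢u _   _   = trans (adj-sym H (suc i) 0F) (neighbour i (i≢u ∘ cong suc))
    clique (suc i) (suc j) i≢u j≢u i≢j = clique₀ i j (i≢u ∘ cong suc) (j≢u ∘ cong suc) (i≢j ∘ cong suc)
  ...       | yes (z , z≢u , nbz) = extend σ a (2 + n) L-bound
                (2[d+m]< (1 + n) ((2 + n) * (1 + n)) ((2 + n) * (3 + n)) 1
                         (count-missing₂ nb z u z≢u nbz (¬-not ¬nbu))
                         (2m≤ (degreeSum-cliquePlusIsolated H₀ u cpi₀)) (solve (n ∷ [])))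
    where
    L-bound : InsertionBound σ a (2 + n)
    L-bound rewrite σa≡u | trans (adj-sym H₀ a u) (isolated₀ a) | nba | ¬-not ¬nbu =
      ≤-trans (≤-reflexive (trans (+-identityʳ (2 + n)) (+-comm 1 (1 + n))))
              (+-monoˡ-≤ 1 (edgesAlong-cliquePlusIsolated H₀ cpi₀ σ))
  fromCliquePlusIsolated u cpi₀@(isolated₀ , clique₀) | no ¬other with nb u ≟ᵇ true
  ... | yes nbu = extend σ u (2 + n) L-bound
        (2[d+m]< 1 ((2 + n) * (1 + n)) ((2 + n) * (3 + n)) (1 + 2 * n)
                 (count≤1 nb u (non-neighbours ¬other))
                 (2m≤ (degreeSum-cliquePlusIsolated H₀ u cpi₀)) (solve (n ∷ [])))
    where
    σ : CycleCover N
    σ = someCycleCover n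
    L-bound : InsertionBound σ u (2 + n)
    L-bound rewrite isolated₀ (perm σ ⟨$⟩ʳ u) | nbu =
      ≤-trans (≤-reflexive (trans (+-identityʳ (2 + n)) (+-comm 1 (1 + n))))
              (+-mono-≤ (edgesAlong-cliquePlusIsolated H₀ cpi₀ σ) (m≤m+n 1 _))
  ... | no ¬nbu = extend σ u (1 + n) L-bound
        (2[d+m]< 0 ((2 + n) * (1 + n)) ((1 + n) * (3 + n)) n
                 (≤-reflexive (count≡0 nb no-neighbours))
                 (2m≤ (degreeSum-cliquePlusIsolated H₀ u cpi₀)) (solve (n ∷ [])))
    where
    σ : CycleCover N
    σ = someCycleCover n
    no-neighbours : ∀ j → nb j ≡ false
    no-neighbours j with j ≟ u
    ... | yes refl = ¬-not ¬nbu
    ... | no j≢u   = non-neighbours ¬other j j≢u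
    L-bound : InsertionBound σ u (1 + n)
    L-bound rewrite isolated₀ (perm σ ⟨$⟩ʳ u) =
      ≤-trans (≤-reflexive (+-identityʳ (1 + n))) (≤-trans (edgesAlong-cliquePlusIsolated H₀ cpi₀ σ) (m≤m+n (X₀ σ) _))

aboveAverage-or-exceptional : ∀ n (H : Graph (3 + n)) → AboveAverageCover H ⊎ Exceptional H
aboveAverage-or-exceptional zero    H = inj₂ (exceptional₃ H)
aboveAverage-or-exceptional (suc n) H with aboveAverage-or-exceptional n (delete₀ H)
... | inj₁ (σ , above)              = inj₁ (insertion-average H σ above)
... | inj₂ (empty e)                = Extension.fromEmpty H e
... | inj₂ (complete k)             = Extension.fromComplete H k
... | inj₂ (star c s)               = Extension.fromStar H c s
... | inj₂ (cliquePlusIsolated u i) = Extension.fromCliquePlusIsolated H u i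

cliquePlusIsolated-large : ∀ n (H : Graph (4 + n)) u → IsCliquePlusIsolated H u → LargeSubgraphOfMaxDeg2 H
cliquePlusIsolated-large n H u cpi =
  subgraphAlong-large H (insertFixed u σ) (insertFixed-noTwoCycles u σ) (begin-strict
    2 * edges H                               ≡⟨ handshake H ⟩
    degreeSum H                               ≤⟨ degreeSum-cliquePlusIsolated H u cpi ⟩
    (3 + n) * (2 + n)                         <⟨ *-monoʳ-< (3 + n) (n<1+n (2 + n)) ⟩
    (3 + n) * (3 + n)                         ≤⟨ *-monoˡ-≤ (3 + n) (edgesAlong-insertFixed u σ H cpi) ⟩
    edgesAlong H (insertFixed u σ) * (3 + n)  ∎)
  where
  open ≤-Reasoning
  σ : CycleCover (3 + n)
  σ = someCycleCover n

claim4p4 : (k : ℕ) → 4 ≤ k → (H : Graph k) → HasEdge H →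
    ¬ IsComplete H → ¬ IsStar H →
    Σ (Graph k) λ H' → SubgraphOf H' H × MaxDegLe H' 2 ×
      (2 * edges H < edges H' * (k ∸ 1))
claim4p4 k 4≤k H (i , j , ij) ¬complete ¬star with m≤n⇒∃[o]m+o≡n 4≤k
... | n , refl with aboveAverage-or-exceptional (suc n) H
...   | inj₁ (σ , above)                = subgraphAlong-large H (perm σ) (cycleCover-noTwoCycles σ) above
...   | inj₂ (empty e)                  = contradiction (trans (sym ij) (e i j)) λ ()
...   | inj₂ (complete k)               = contradiction k ¬complete
...   | inj₂ (star c s)                 = contradiction (c , s) ¬star
...   | inj₂ (cliquePlusIsolated u cpi) = cliquePlusIsolated-large n H u cpi
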